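{- Let \(P\) be a path graph on at least \(2\) vertices, let \(k \geq 1\), and let \(\{L_v\}_{v \in V(P)}\) be a list assignment with \(L_v \subset \mathbb{N}\) and \(|L_v| = k\) for every vertex \(v\). Let \(V(P) = I_1 \cup I_2\) be the partition of the vertex set into two independent sets. Then there is an assignment of colors \(c(u) \in L_u\) to the vertices \(u \in I_1\) such that every \(v \in I_2\) loses at most one color from its list, i.e. \(|L_v \cap \{c(u) : u \in I_1, \ u \text{ adjacent to } v\}| \leq 1\) for all \(v \in I_2\).
   Context: A path graph is a graph whose vertices can be ordered \(v_1, \dots, v_n\) with edges exactly \(v_iv_{i+1}\); its vertices alternate between the two classes \(I_1, I_2\). -}

module Defs where

open import Data.Nat using (ℕ; zero; suc; _+_; _%_)
open import Data.Nat.Properties using (_≟_)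
open import Data.Fin using (Fin; toℕ)
open import Data.List using (List; filter; length; allFin)
open import Data.List.Membership.Propositional using (_∈_)
open import Data.List.Relation.Unary.Any using (any?)
open import Relation.Binary.PropositionalEquality using (_≡_)
open import Relation.Nullary using (Dec)
open import Relation.Nullary.Decidable using (_×-dec_; _⊎-dec_)
open import Data.Sum using (_⊎_)

Adj : {n : ℕ} → Fin n → Fin n → Set
Adj i j = (toℕ j ≡ suc (toℕ i)) ⊎ (toℕ i ≡ suc (toℕ j))

adj? : {n : ℕ} → (i j : Fin n) → Dec (Adj i j)
adj? i j = (toℕ j ≟ suc (toℕ i)) ⊎-dec (toℕ i ≟ suc (toℕ j))

-- The two independent classes of the bipartition: vertices whose index has
-- parity p form one class.  InClass p v  means  toℕ v mod 2 ≡ p.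
InClass : {n : ℕ} → ℕ → Fin n → Set
InClass p v = toℕ v % 2 ≡ p

inClass? : {n : ℕ} → (p : ℕ) → (v : Fin n) → Dec (InClass p v)
inClass? p v = (toℕ v % 2) ≟ p

-- Given the class I₁ (parity p) and a colouring c (only values on I₁ matter),
-- the colours lost by v: the elements x of L v such that x = c u for some
-- u ∈ I₁ adjacent to v.
lostColours : {n : ℕ} → ℕ → (Fin n → List ℕ) → (Fin n → ℕ) → Fin n → List ℕ
lostColours {n} p L c v =
  filter (λ x → any? (λ u → (inClass? p u ×-dec adj? u v) ×-dec (x ≟ c u)) (allFin n)) (L v)

-- Colour the path greedily from left to right, each vertex looking two steps back, so that
-- the two neighbours v − 1 and v + 1 of every vertex v receive colours that are equal or
-- not both in L v.  Given the colour y of v − 1, the vertex v + 1 takes y if it can;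
-- otherwise a colour outside L v if it has one; otherwise L (v + 1) ⊆ L v, and as both lists
-- have k distinct elements while y ∉ L (v + 1), pigeonhole forces y ∉ L v.
module Submission where

open import Defs
open import Data.Nat using (ℕ; suc; _≤_; _<_; _≥_; _∸_; _<?_; z≤n; s≤s)
open import Data.Nat.Properties using (≤-refl; <⇒≤; n≮n; module ≤-Reasoning)
open import Data.Fin using (Fin; toℕ; fromℕ<)
open import Data.Fin.Properties using (fromℕ<-toℕ; toℕ<n)
open import Data.List using (List; []; _∷_; length)
open import Data.List.Properties using (length-removeAt′)
open import Data.List.Membership.Propositional using (_∈_; find)
open import Data.List.Membership.Propositional.Properties using (∈-lookup; ∈-filter⁻)
open import Data.List.Membership.DecPropositional Data.Nat._≟_ using (_∈?_)
open import Data.List.Relation.Binary.Subset.Propositional using (_⊆_)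
open import Data.List.Relation.Unary.All as All using (all?; _∷_)
open import Data.List.Relation.Unary.All.Properties using (¬All⇒Any¬)
open import Data.List.Relation.Unary.AllPairs using ([]; _∷_)
open import Data.List.Relation.Unary.Any as Any using (here; there; _─_)
open import Data.List.Relation.Unary.Any.Properties using (lookup-result)
open import Data.List.Relation.Unary.Unique.Propositional using (Unique)
open import Data.List.Relation.Unary.Unique.Propositional.Properties using (filter⁺)
open import Data.Product using (Σ; ∃; _×_; _,_)
open import Data.Sum using (_⊎_; inj₁; inj₂)
open import Level using (Level)
open import Relation.Nullary using (yes; no; contradiction)
open import Relation.Binary.PropositionalEquality using (_≡_; _≢_; refl; sym; trans; cong; subst; ≢-sym)

private
  variable
    a : Level
    A : Set a
    x y : A
    xs ys : List A

∈-─ : (x∈ys : x ∈ ys) → y ∈ ys → y ≢ x → y ∈ (ys ─ x∈ys)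
∈-─ (here refl)  (here refl)  y≢x = contradiction refl y≢x
∈-─ (here refl)  (there y∈ys) _   = y∈ys
∈-─ (there _)    (here refl)  _   = here refl
∈-─ (there x∈ys) (there y∈ys) y≢x = there (∈-─ x∈ys y∈ys y≢x)

unique∧⊆⇒length≤ : Unique xs → xs ⊆ ys → length xs ≤ length ys
unique∧⊆⇒length≤ [] _ = z≤n
unique∧⊆⇒length≤ {xs = x ∷ xs} {ys = ys} (x∉xs ∷ xs!) xs⊆ys = begin
  suc (length xs)           ≤⟨ s≤s (unique∧⊆⇒length≤ xs! xs⊆ys─x) ⟩
  suc (length (ys ─ x∈ys))  ≡⟨ sym (length-removeAt′ ys (Any.index x∈ys)) ⟩
  length ys                 ∎
  where
  open ≤-Reasoning
  x∈ys = xs⊆ys (here refl)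
  xs⊆ys─x : xs ⊆ (ys ─ x∈ys)
  xs⊆ys─x z∈xs = ∈-─ x∈ys (xs⊆ys (there z∈xs)) (≢-sym (All.lookup x∉xs z∈xs))

unique∧constant⇒length≤1 : Unique xs → (∀ {x y} → x ∈ xs → y ∈ xs → x ≡ y) → length xs ≤ 1
unique∧constant⇒length≤1 {xs = []}        _               _        = z≤n
unique∧constant⇒length≤1 {xs = _ ∷ []}    _               _        = ≤-refl
unique∧constant⇒length≤1 {xs = _ ∷ _ ∷ _} ((x≢y ∷ _) ∷ _) constant =
  contradiction (constant (here refl) (there (here refl))) x≢y

∈-lostColours⁻ : ∀ {n} p (L : Fin n → List ℕ) c v {x} → x ∈ lostColours p L c v →
                 x ∈ L v × ∃ λ u → Adj u v × x ≡ c u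
∈-lostColours⁻ p L c v x∈lost with ∈-filter⁻ _ {xs = L v} x∈lost
... | x∈L , lost with find lost
...   | u , _ , (_ , u~v) , x≡cu = x∈L , u , u~v , x≡cu

-- Junk value 0 on [].
head₀ : List ℕ → ℕ
head₀ []      = 0
head₀ (x ∷ _) = x

head₀-∈ : ∀ {l} → 0 < length l → head₀ l ∈ l
head₀-∈ {_ ∷ _} _ = here refl

-- The colour of a vertex whose list is Lw, two steps after a vertex coloured y, with the
-- vertex in between having list Lv.
next : ℕ → List ℕ → List ℕ → ℕ
next y Lv Lw with y ∈? Lw | all? (_∈? Lv) Lw
... | yes _ | _         = y
... | no _  | yes _     = head₀ Lw
... | no _  | no Lw⊈Lv  = Any.lookup (¬All⇒Any¬ (_∈? Lv) Lw Lw⊈Lv)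

next-∈ : ∀ y Lv Lw → 0 < length Lw → next y Lv Lw ∈ Lw
next-∈ y Lv Lw nonempty with y ∈? Lw | all? (_∈? Lv) Lw
... | yes y∈Lw | _       = y∈Lw
... | no _     | yes _   = head₀-∈ nonempty
... | no _     | no Lw⊈Lv = ∈-lookup (Any.index (¬All⇒Any¬ (_∈? Lv) Lw Lw⊈Lv))

next-agrees : ∀ y Lv Lw → Unique Lw → length Lw ≡ length Lv →
              y ∈ Lv → next y Lv Lw ∈ Lv → next y Lv Lw ≡ y
next-agrees y Lv Lw Lw! |Lw|≡|Lv| y∈Lv next∈Lv with y ∈? Lw | all? (_∈? Lv) Lw
... | yes _    | _         = refl
... | no _     | no Lw⊈Lv  = contradiction next∈Lv (lookup-result (¬All⇒Any¬ (_∈? Lv) Lw Lw⊈Lv))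
... | no y∉Lw  | yes Lw⊆Lv = contradiction (subst (length (y ∷ Lw) ≤_) (sym |Lw|≡|Lv|) y∷Lw≤Lv) (n≮n (length Lw))
  where
  y∷Lw⊆Lv : y ∷ Lw ⊆ Lv
  y∷Lw⊆Lv (here refl)  = y∈Lv
  y∷Lw⊆Lv (there z∈Lw) = All.lookup Lw⊆Lv z∈Lw

  y∷Lw≤Lv : length (y ∷ Lw) ≤ length Lv
  y∷Lw≤Lv = unique∧⊆⇒length≤ (All.tabulate (λ { z∈Lw refl → y∉Lw z∈Lw }) ∷ Lw!) y∷Lw⊆Lv

module GreedyColouring {n k : ℕ} (L : Fin n → List ℕ) (L! : ∀ v → Unique (L v))
                       (|L|≡k : ∀ v → length (L v) ≡ k) (k≥1 : k ≥ 1) where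

  -- L extended by [] past the last vertex, so that colours can be defined by recursion on ℕ.
  Lℕ : ℕ → List ℕ
  Lℕ i with i <? n
  ... | yes i<n = L (fromℕ< i<n)
  ... | no _    = []

  Lℕ-toℕ : ∀ u → Lℕ (toℕ u) ≡ L u
  Lℕ-toℕ u with toℕ u <? n
  ... | yes u<n = cong L (fromℕ<-toℕ u u<n)
  ... | no u≮n  = contradiction (toℕ<n u) u≮n

  Lℕ-lift : (P : List ℕ → Set) → (∀ v → P (L v)) → ∀ {i} → i < n → P (Lℕ i)
  Lℕ-lift P PL {i} i<n with i <? n
  ... | yes _   = PL _
  ... | no i≮n  = contradiction i<n i≮n

  Lℕ-length : ∀ {i} → i < n → length (Lℕ i) ≡ k
  Lℕ-length = Lℕ-lift (λ l → length l ≡ k) |L|≡k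

  Lℕ-nonempty : ∀ {i} → i < n → 0 < length (Lℕ i)
  Lℕ-nonempty i<n = subst (0 <_) (sym (Lℕ-length i<n)) k≥1

  colour : ℕ → ℕ
  colour 0             = head₀ (Lℕ 0)
  colour 1             = head₀ (Lℕ 1)
  colour (suc (suc j)) = next (colour j) (Lℕ (suc j)) (Lℕ (suc (suc j)))

  colour-∈ : ∀ {i} → i < n → colour i ∈ Lℕ i
  colour-∈ {0}           i<n = head₀-∈ (Lℕ-nonempty i<n)
  colour-∈ {1}           i<n = head₀-∈ (Lℕ-nonempty i<n)
  colour-∈ {suc (suc j)} i<n = next-∈ (colour j) (Lℕ (suc j)) _ (Lℕ-nonempty i<n)

  colour-agrees : ∀ {j} → suc (suc j) < n → colour j ∈ Lℕ (suc j) →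
                  colour (suc (suc j)) ∈ Lℕ (suc j) → colour j ≡ colour (suc (suc j))
  colour-agrees {j} j+2<n cj∈ cj+2∈ = sym (next-agrees (colour j) _ _
    (Lℕ-lift Unique L! j+2<n) (trans (Lℕ-length j+2<n) (sym (Lℕ-length (<⇒≤ j+2<n)))) cj∈ cj+2∈)

  neighbours-agree : ∀ {s s′ t} → s < n → s′ < n →
                     (t ≡ suc s ⊎ s ≡ suc t) → (t ≡ suc s′ ⊎ s′ ≡ suc t) →
                     colour s ∈ Lℕ t → colour s′ ∈ Lℕ t → colour s ≡ colour s′
  neighbours-agree _   _    (inj₁ refl) (inj₁ refl) _   _    = refl
  neighbours-agree _   _    (inj₂ refl) (inj₂ refl) _   _    = refl
  neighbours-agree _   s′<n (inj₁ refl) (inj₂ refl) cs∈ cs′∈ = colour-agrees s′<n cs∈ cs′∈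
  neighbours-agree s<n _    (inj₂ refl) (inj₁ refl) cs∈ cs′∈ = sym (colour-agrees s<n cs′∈ cs∈)

-- Every vertex gets coloured, so neither the class p nor n ≥ 2 plays a role.
lemma3p2 : (n : ℕ) → n ≥ 2 → (k : ℕ) → k ≥ 1 →
    (L : Fin n → List ℕ) →
    (∀ v → Unique (L v)) → (∀ v → length (L v) ≡ k) →
    (p : ℕ) → p ≤ 1 →
    Σ (Fin n → ℕ) (λ c →
    (∀ u → InClass p u → c u ∈ L u) ×
    (∀ v → InClass (1 ∸ p) v → length (lostColours p L c v) ≤ 1))
lemma3p2 n _ k k≥1 L L! |L|≡k p _ = c , (λ u _ → c-∈ u) , λ v _ → at-most-one-lost v
  where
  open GreedyColouring L L! |L|≡k k≥1

  c : Fin n → ℕ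
  c u = colour (toℕ u)

  c-∈ : ∀ u → c u ∈ L u
  c-∈ u = subst (c u ∈_) (Lℕ-toℕ u) (colour-∈ (toℕ<n u))

  at-most-one-lost : ∀ v → length (lostColours p L c v) ≤ 1
  at-most-one-lost v = unique∧constant⇒length≤1 (filter⁺ _ (L! v)) lost-constant
    where
    lost-constant : ∀ {x y} → x ∈ lostColours p L c v → y ∈ lostColours p L c v → x ≡ y
    lost-constant x∈ y∈ with ∈-lostColours⁻ p L c v x∈ | ∈-lostColours⁻ p L c v y∈
    ... | x∈L , u , u~v , refl | y∈L , u′ , u′~v , refl =
      neighbours-agree (toℕ<n u) (toℕ<n u′) u~v u′~v (into-Lℕ x∈L) (into-Lℕ y∈L)
      where
      into-Lℕ : ∀ {z} → z ∈ L v → z ∈ Lℕ (toℕ v)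
      into-Lℕ = subst (_ ∈_) (sym (Lℕ-toℕ v))
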